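{- Let $k\ge1$ and let $H_1=(V,F_1)$ be a $k$-edge connected multigraph whose edges are partitioned into safe and unsafe edges, $F_1=\mathscr{S}_1\,\dot\cup\,\mathscr{U}_1$. Define $f:2^V\to\{0,1\}$ by $f(S)=1$ if and only if $|\delta_{H_1}(S)|=k$ and $\delta_{H_1}(S)\cap\mathscr{U}_1\ne\emptyset$. Then $f$ is uncrossable.
   Context: $\delta_{H_1}(S)$ is the set of edges of $H_1$ with exactly one endpoint in $S$. A function $f:2^{V}\to\{0,1\}$ is uncrossable if $f(V)=0$ and (i) $f(S)=f(V\setminus S)$ for all $S\subseteq V$, and (ii) for any $A,B\subseteq V$ with $f(A)=f(B)=1$, either $f(A\cap B)=f(A\cup B)=1$ or $f(A\setminus B)=f(B\setminus A)=1$. -}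

module Defs where

open import Data.Nat using (ℕ; _≥_; _≟_)
open import Data.Bool using (Bool; true; false; _∧_; _xor_)
open import Data.Fin using (Fin)
open import Data.Fin.Subset using (Subset; ⊤; ⊥; ∁; _∩_; _∪_; _─_; ∣_∣; Nonempty)
open import Data.Fin.Subset.Properties using (nonempty?)
open import Data.Vec using (lookup; tabulate)
open import Data.Product using (_×_; proj₁; proj₂)
open import Data.Sum using (_⊎_)
open import Relation.Binary.PropositionalEquality using (_≡_; _≢_)
open import Relation.Nullary using (does)

-- A finite multigraph on vertex set V = Fin n with m edges (parallel edges
-- and loops allowed): edge e has endpoints  ends e = (u , v).
record Multigraph (n : ℕ) : Set where
  field
    m    : ℕ
    ends : Fin m → Fin n × Fin n
open Multigraph public

δ : ∀ {n} (H : Multigraph n) → Subset n → Subset (m H)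
δ H S = tabulate λ e → lookup S (proj₁ (ends H e)) xor lookup S (proj₂ (ends H e))

EdgeConnected : ∀ {n} → ℕ → Multigraph n → Set
EdgeConnected k H = ∀ S → S ≢ ⊥ → S ≢ ⊤ → ∣ δ H S ∣ ≥ k

Uncrossable : ∀ {n} → (Subset n → Bool) → Set
Uncrossable {n} f =
  f ⊤ ≡ false
  × (∀ (S : Subset n) → f S ≡ f (∁ S))
  × (∀ (A B : Subset n) → f A ≡ true → f B ≡ true →
       (f (A ∩ B) ≡ true × f (A ∪ B) ≡ true)
       ⊎ (f (A ─ B) ≡ true × f (B ─ A) ≡ true))

-- f(S) = 1  iff  |δ(S)| = k  and  δ(S) ∩ U ≠ ∅, where U ⊆ F is the set of
-- unsafe edges (the safe edges are its complement).
fCut : ∀ {n} (k : ℕ) (H : Multigraph n) (U : Subset (m H)) → Subset n → Bool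
fCut k H U S = does (∣ δ H S ∣ ≟ k) ∧ does (nonempty? (δ H S ∩ U))

-- For vertex sets A and B every edge contributes equally to both sides of
--   |δA| + |δB| = |δ(A∩B)| + |δ(A∪B)| + 2 d(A─B, B─A)
--               = |δ(A─B)| + |δ(B─A)| + 2 d(A∩B, V─(A∪B)),
-- where d(X, Y) counts the edges joining X and Y.  If |δA| = |δB| = k and the four
-- corners A∩B, A∪B, A─B, B─A are all proper, k-edge-connectivity makes every corner a
-- minimum cut and leaves no edge between opposite corners.  An unsafe edge of δA then lies
-- in δ(A∩B) ∩ δ(B─A) or in δ(A∪B) ∩ δ(A─B), an unsafe edge of δB in δ(A∩B) ∩ δ(A─B) or in
-- δ(A∪B) ∩ δ(B─A), and each of the four combinations puts unsafe edges into both cuts of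
-- one of the two pairs.  If a corner is ∅ or V, one of the pairs is {A, B} or {V─B, V─A}.

module Submission where

open import Data.Bool using (Bool; true; false; not; _∧_; _∨_; _xor_)
open import Data.Bool.Properties using (¬-not; not-involutive; not-distribˡ-xor; not-distribʳ-xor; xor-same)
import Data.Bool.Properties as Bool
open import Data.Fin using (Fin; zero; suc)
open import Data.Fin.Subset using (Subset; ⊤; ⊥; ∁; _∩_; _∪_; _─_; ∣_∣; _∈_; _⊆_)
open import Data.Fin.Subset.Properties
  using (nonempty?; ∣⊥∣≡0; ⊆-antisym; ⊆⊤; ⊥⊆; p∩q⊆p; p─q⊆p; p⊆p∪q; x∈p∩q⁺; x∈p∩q⁻; ∩-comm; ∪-comm)
open import Data.Nat using (ℕ; zero; suc; _+_; _*_; _≤_; _<_; _≥_; _≟_)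
open import Data.Nat.Properties
  using ( <⇒≢; ≤-antisym; ≤-trans; +-monoˡ-≤; +-monoʳ-≤; +-cancelˡ-≤; +-cancelʳ-≤; +-cancelˡ-≡
        ; m≤m+n; m+n≡0⇒m≡0; +-identityʳ; +-commutativeSemigroup)
open import Algebra.Properties.CommutativeSemigroup +-commutativeSemigroup using (interchange)
open import Data.Nat.Tactic.RingSolver using (solve-∀)
open import Data.Product using (_×_; _,_; proj₁; proj₂; ∃)
open import Data.Sum using (_⊎_; inj₁; inj₂)
open import Data.Vec using (Vec; _∷_; lookup; tabulate; replicate)
open import Data.Vec.Properties
  using ( lookup-zipWith; lookup-map; lookup-replicate; lookup∘tabulate; tabulate∘lookup; tabulate-cong
        ; ≡-dec; []=⇒lookup; lookup⇒[]=)
open import Function using (_∘_)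
open import Relation.Binary.Definitions using (DecidableEquality)
open import Relation.Binary.PropositionalEquality
open import Relation.Nullary using (yes; no; does)
open import Relation.Nullary.Decidable using (Dec; dec-true; _×-dec_)

open import Defs

toℕ : Bool → ℕ
toℕ false = 0
toℕ true  = 1

does≡true⇒ : ∀ {P : Set} (p? : Dec P) → does p? ≡ true → P
does≡true⇒ (yes p) _ = p

not-xor-not : ∀ x y → not x xor not y ≡ x xor y
not-xor-not x y = begin
  not x xor not y      ≡⟨ sym (not-distribˡ-xor x (not y)) ⟩
  not (x xor not y)    ≡⟨ cong not (sym (not-distribʳ-xor x y)) ⟩
  not (not (x xor y))  ≡⟨ not-involutive (x xor y) ⟩
  x xor y              ∎
  where open ≡-Reasoning

-- In the truth tables below, x and y record whether one endpoint of an edge lies in A and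
-- in B, and x′ and y′ the same for the other endpoint.
xor-submodular : ∀ x y x′ y′ →
  toℕ (x xor x′) + toℕ (y xor y′) ≡
  toℕ ((x ∧ y) xor (x′ ∧ y′)) + toℕ ((x ∨ y) xor (x′ ∨ y′))
    + 2 * toℕ ((x ∧ not y) ∧ (y′ ∧ not x′) ∨ (y ∧ not x) ∧ (x′ ∧ not y′))
xor-submodular true  true  true  true  = refl
xor-submodular true  true  true  false = refl
xor-submodular true  true  false true  = refl
xor-submodular true  true  false false = refl
xor-submodular true  false true  true  = refl
xor-submodular true  false true  false = refl
xor-submodular true  false false true  = refl
xor-submodular true  false false false = refl
xor-submodular false true  true  true  = refl
xor-submodular false true  true  false = refl
xor-submodular false true  false true  = refl
xor-submodular false true  false false = refl
xor-submodular false false true  true  = refl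
xor-submodular false false true  false = refl
xor-submodular false false false true  = refl
xor-submodular false false false false = refl

xor-posimodular : ∀ x y x′ y′ →
  toℕ (x xor x′) + toℕ (y xor y′) ≡
  toℕ ((x ∧ not y) xor (x′ ∧ not y′)) + toℕ ((y ∧ not x) xor (y′ ∧ not x′))
    + 2 * toℕ ((x ∧ y) ∧ not (x′ ∨ y′) ∨ not (x ∨ y) ∧ (x′ ∧ y′))
xor-posimodular true  true  true  true  = refl
xor-posimodular true  true  true  false = refl
xor-posimodular true  true  false true  = refl
xor-posimodular true  true  false false = refl
xor-posimodular true  false true  true  = refl
xor-posimodular true  false true  false = refl
xor-posimodular true  false false true  = refl
xor-posimodular true  false false false = refl
xor-posimodular false true  true  true  = refl
xor-posimodular false true  true  false = refl
xor-posimodular false true  false true  = refl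
xor-posimodular false true  false false = refl
xor-posimodular false false true  true  = refl
xor-posimodular false false true  false = refl
xor-posimodular false false false true  = refl
xor-posimodular false false false false = refl

xor-uncrossˡ : ∀ x y x′ y′ →
  (x ∧ not y) ∧ (y′ ∧ not x′) ∨ (y ∧ not x) ∧ (x′ ∧ not y′) ≡ false →
  (x ∧ y) ∧ not (x′ ∨ y′) ∨ not (x ∨ y) ∧ (x′ ∧ y′) ≡ false →
  x xor x′ ≡ true →
  ((x ∧ y) xor (x′ ∧ y′) ≡ true × (y ∧ not x) xor (y′ ∧ not x′) ≡ true)
  ⊎ ((x ∨ y) xor (x′ ∨ y′) ≡ true × (x ∧ not y) xor (x′ ∧ not y′) ≡ true)
xor-uncrossˡ true  true  false true  _  _  _  = inj₁ (refl , refl)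
xor-uncrossˡ true  false false false _  _  _  = inj₂ (refl , refl)
xor-uncrossˡ false true  true  true  _  _  _  = inj₁ (refl , refl)
xor-uncrossˡ false false true  false _  _  _  = inj₂ (refl , refl)
xor-uncrossˡ true  true  false false _  () _
xor-uncrossˡ true  false false true  () _  _
xor-uncrossˡ false true  true  false () _  _
xor-uncrossˡ false false true  true  _  () _
xor-uncrossˡ true  _     true  _     _  _  ()
xor-uncrossˡ false _     false _     _  _  ()

xor-uncrossʳ : ∀ x y x′ y′ →
  (x ∧ not y) ∧ (y′ ∧ not x′) ∨ (y ∧ not x) ∧ (x′ ∧ not y′) ≡ false →
  (x ∧ y) ∧ not (x′ ∨ y′) ∨ not (x ∨ y) ∧ (x′ ∧ y′) ≡ false →
  y xor y′ ≡ true →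
  ((x ∧ y) xor (x′ ∧ y′) ≡ true × (x ∧ not y) xor (x′ ∧ not y′) ≡ true)
  ⊎ ((x ∨ y) xor (x′ ∨ y′) ≡ true × (y ∧ not x) xor (y′ ∧ not x′) ≡ true)
xor-uncrossʳ true  true  true  false _  _  _  = inj₁ (refl , refl)
xor-uncrossʳ false true  false false _  _  _  = inj₂ (refl , refl)
xor-uncrossʳ true  false true  true  _  _  _  = inj₁ (refl , refl)
xor-uncrossʳ false false false true  _  _  _  = inj₂ (refl , refl)
xor-uncrossʳ true  true  false false _  () _
xor-uncrossʳ false true  true  false () _  _
xor-uncrossʳ true  false false true  () _  _
xor-uncrossʳ false false true  true  _  () _
xor-uncrossʳ _     true  _     true  _  _  ()
xor-uncrossʳ _     false _     false _  _  ()

lookup-ext : ∀ {A : Set} {n} {xs ys : Vec A n} → (∀ i → lookup xs i ≡ lookup ys i) → xs ≡ ys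
lookup-ext {xs = xs} {ys} eq = begin
  xs                   ≡⟨ tabulate∘lookup xs ⟨
  tabulate (lookup xs) ≡⟨ tabulate-cong eq ⟩
  tabulate (lookup ys) ≡⟨ tabulate∘lookup ys ⟩
  ys                   ∎
  where open ≡-Reasoning

module _ {n : ℕ} where

  lookup-∩ : ∀ (p q : Subset n) i → lookup (p ∩ q) i ≡ lookup p i ∧ lookup q i
  lookup-∩ p q i = lookup-zipWith _∧_ i p q

  lookup-∪ : ∀ (p q : Subset n) i → lookup (p ∪ q) i ≡ lookup p i ∨ lookup q i
  lookup-∪ p q i = lookup-zipWith _∨_ i p q

  lookup-∁ : ∀ (p : Subset n) i → lookup (∁ p) i ≡ not (lookup p i)
  lookup-∁ p i = lookup-map i not p

  lookup-⊥ : ∀ {p : Subset n} → p ≡ ⊥ → ∀ i → lookup p i ≡ false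
  lookup-⊥ refl i = lookup-replicate i false

  lookup-⊤ : ∀ {p : Subset n} → p ≡ ⊤ → ∀ i → lookup p i ≡ true
  lookup-⊤ refl i = lookup-replicate i true

lookup-─ : ∀ {n} (p q : Subset n) i → lookup (p ─ q) i ≡ lookup p i ∧ not (lookup q i)
lookup-─ (x ∷ p) (true  ∷ q) zero    = sym (Bool.∧-zeroʳ x)
lookup-─ (x ∷ p) (false ∷ q) zero    = sym (Bool.∧-identityʳ x)
lookup-─ (_ ∷ p) (_     ∷ q) (suc i) = lookup-─ p q i

module _ {n : ℕ} {p q : Subset n} where

  ∩≡⊥⇒─≡ : p ∩ q ≡ ⊥ → p ─ q ≡ p
  ∩≡⊥⇒─≡ eq = lookup-ext λ i →
    trans (lookup-─ p q i) (pointwise _ _ (trans (sym (lookup-∩ p q i)) (lookup-⊥ eq i)))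
    where
    pointwise : ∀ x y → x ∧ y ≡ false → x ∧ not y ≡ x
    pointwise true  true  ()
    pointwise true  false _ = refl
    pointwise false _     _ = refl

  ∪≡⊤⇒─≡∁ : p ∪ q ≡ ⊤ → p ─ q ≡ ∁ q
  ∪≡⊤⇒─≡∁ eq = lookup-ext λ i →
    trans (lookup-─ p q i) (trans (pointwise _ _ (trans (sym (lookup-∪ p q i)) (lookup-⊤ eq i)))
                                  (sym (lookup-∁ q i)))
    where
    pointwise : ∀ x y → x ∨ y ≡ true → x ∧ not y ≡ not y
    pointwise true  _     _ = refl
    pointwise false true  _ = refl
    pointwise false false ()

  ─≡⊥⇒∩≡ : p ─ q ≡ ⊥ → p ∩ q ≡ p
  ─≡⊥⇒∩≡ eq = lookup-ext λ i →
    trans (lookup-∩ p q i) (pointwise _ _ (trans (sym (lookup-─ p q i)) (lookup-⊥ eq i)))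
    where
    pointwise : ∀ x y → x ∧ not y ≡ false → x ∧ y ≡ x
    pointwise true  true  _ = refl
    pointwise true  false ()
    pointwise false _     _ = refl

  ─≡⊥⇒∪≡ : p ─ q ≡ ⊥ → p ∪ q ≡ q
  ─≡⊥⇒∪≡ eq = lookup-ext λ i →
    trans (lookup-∪ p q i) (pointwise _ _ (trans (sym (lookup-─ p q i)) (lookup-⊥ eq i)))
    where
    pointwise : ∀ x y → x ∧ not y ≡ false → x ∨ y ≡ y
    pointwise true  true  _ = refl
    pointwise true  false ()
    pointwise false _     _ = refl

  ⊆-≢⊤ : p ⊆ q → q ≢ ⊤ → p ≢ ⊤
  ⊆-≢⊤ p⊆q q≢⊤ p≡⊤ = q≢⊤ (⊆-antisym ⊆⊤ (subst (_⊆ q) p≡⊤ p⊆q))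

  ⊆-≢⊥ : p ⊆ q → p ≢ ⊥ → q ≢ ⊥
  ⊆-≢⊥ p⊆q p≢⊥ q≡⊥ = p≢⊥ (⊆-antisym (subst (p ⊆_) q≡⊥ p⊆q) ⊥⊆)

∣x∷p∣ : ∀ {n} x (p : Subset n) → ∣ x ∷ p ∣ ≡ toℕ x + ∣ p ∣
∣x∷p∣ true  p = refl
∣x∷p∣ false p = refl

∣x∷p∣≡0 : ∀ {n} x (p : Subset n) → ∣ x ∷ p ∣ ≡ 0 → x ≡ false × ∣ p ∣ ≡ 0
∣x∷p∣≡0 false p eq = refl , eq

∣tabulate∣≡0 : ∀ {n} (f : Fin n → Bool) → ∣ tabulate f ∣ ≡ 0 → ∀ i → f i ≡ false
∣tabulate∣≡0 f eq zero    = proj₁ (∣x∷p∣≡0 (f zero) (tabulate (f ∘ suc)) eq)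
∣tabulate∣≡0 f eq (suc i) = ∣tabulate∣≡0 (f ∘ suc) (proj₂ (∣x∷p∣≡0 (f zero) (tabulate (f ∘ suc)) eq)) i

∣tabulate∣-identity : ∀ {n} (f g h j l : Fin n → Bool) →
  (∀ i → toℕ (f i) + toℕ (g i) ≡ toℕ (h i) + toℕ (j i) + 2 * toℕ (l i)) →
  ∣ tabulate f ∣ + ∣ tabulate g ∣ ≡ ∣ tabulate h ∣ + ∣ tabulate j ∣ + 2 * ∣ tabulate l ∣
∣tabulate∣-identity {zero}  f g h j l eq = refl
∣tabulate∣-identity {suc n} f g h j l eq = begin
  ∣ tabulate f ∣ + ∣ tabulate g ∣
    ≡⟨ cong₂ _+_ (∣x∷p∣ (f zero) F) (∣x∷p∣ (g zero) G) ⟩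
  (toℕ (f zero) + ∣ F ∣) + (toℕ (g zero) + ∣ G ∣)
    ≡⟨ interchange (toℕ (f zero)) (∣ F ∣) (toℕ (g zero)) (∣ G ∣) ⟩
  (toℕ (f zero) + toℕ (g zero)) + (∣ F ∣ + ∣ G ∣)
    ≡⟨ cong₂ _+_ (eq zero) (∣tabulate∣-identity (f ∘ suc) (g ∘ suc) (h ∘ suc) (j ∘ suc) (l ∘ suc)
                                                 (eq ∘ suc)) ⟩
  (toℕ (h zero) + toℕ (j zero) + 2 * toℕ (l zero)) + (∣ R ∣ + ∣ S ∣ + 2 * ∣ T ∣)
    ≡⟨ regroup (toℕ (h zero)) (∣ R ∣) (toℕ (j zero)) (∣ S ∣) (toℕ (l zero)) (∣ T ∣) ⟩
  (toℕ (h zero) + ∣ R ∣) + (toℕ (j zero) + ∣ S ∣) + 2 * (toℕ (l zero) + ∣ T ∣)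
    ≡⟨ cong₂ _+_ (cong₂ _+_ (∣x∷p∣ (h zero) R) (∣x∷p∣ (j zero) S))
                 (cong (2 *_) (∣x∷p∣ (l zero) T)) ⟨
  ∣ tabulate h ∣ + ∣ tabulate j ∣ + 2 * ∣ tabulate l ∣
    ∎
  where
  open ≡-Reasoning
  F G R S T : Subset n
  F = tabulate (f ∘ suc)
  G = tabulate (g ∘ suc)
  R = tabulate (h ∘ suc)
  S = tabulate (j ∘ suc)
  T = tabulate (l ∘ suc)
  regroup : ∀ a b c d e f → (a + c + 2 * e) + (b + d + 2 * f) ≡ (a + b) + (c + d) + 2 * (e + f)
  regroup = solve-∀

+-tight : ∀ {k x y c} → k ≤ x → k ≤ y → k + k ≡ x + y + 2 * c → x ≡ k × y ≡ k × c ≡ 0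
+-tight {k} {x} {y} {c} k≤x k≤y eq = x≡k , y≡k , c≡0
  where
  x+y≤k+k : x + y ≤ k + k
  x+y≤k+k = subst (x + y ≤_) (sym eq) (m≤m+n (x + y) (2 * c))
  x≡k : x ≡ k
  x≡k = ≤-antisym (+-cancelʳ-≤ k x k (≤-trans (+-monoʳ-≤ x k≤y) x+y≤k+k)) k≤x
  y≡k : y ≡ k
  y≡k = ≤-antisym (+-cancelˡ-≤ k y k (≤-trans (+-monoˡ-≤ y k≤x) x+y≤k+k)) k≤y
  c≡0 : c ≡ 0
  c≡0 = m+n≡0⇒m≡0 c (sym (+-cancelˡ-≡ (x + y) 0 (2 * c)
          (trans (+-identityʳ (x + y)) (trans (cong₂ _+_ x≡k y≡k) eq))))

module _ {n : ℕ} (H : Multigraph n) where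

  private
    u v : Fin (m H) → Fin n
    u e = proj₁ (ends H e)
    v e = proj₂ (ends H e)

  crosses : Subset n → Fin (m H) → Bool
  crosses S e = lookup S (u e) xor lookup S (v e)

  joins : Subset n → Subset n → Fin (m H) → Bool
  joins X Y e = lookup X (u e) ∧ lookup Y (v e) ∨ lookup Y (u e) ∧ lookup X (v e)

  edgesBetween : Subset n → Subset n → Subset (m H)
  edgesBetween X Y = tabulate (joins X Y)

  ∈δ⇒crosses : ∀ S {e} → e ∈ δ H S → crosses S e ≡ true
  ∈δ⇒crosses S {e} e∈δ = trans (sym (lookup∘tabulate (crosses S) e)) ([]=⇒lookup e∈δ)

  crosses⇒∈δ : ∀ S {e} → crosses S e ≡ true → e ∈ δ H S
  crosses⇒∈δ S {e} c = lookup⇒[]= e (δ H S) (trans (lookup∘tabulate (crosses S) e) c)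

  δ-replicate : ∀ b → δ H (replicate n b) ≡ ⊥
  δ-replicate b = lookup-ext λ e → begin
    lookup (δ H (replicate n b)) e ≡⟨ lookup∘tabulate (crosses (replicate n b)) e ⟩
    crosses (replicate n b) e      ≡⟨ cong₂ _xor_ (lookup-replicate (u e) b) (lookup-replicate (v e) b) ⟩
    b xor b                        ≡⟨ xor-same b ⟩
    false                          ≡⟨ lookup-replicate e false ⟨
    lookup ⊥ e                     ∎
    where open ≡-Reasoning

  δ-∁ : ∀ S → δ H (∁ S) ≡ δ H S
  δ-∁ S = tabulate-cong λ e → trans (cong₂ _xor_ (lookup-∁ S (u e)) (lookup-∁ S (v e)))
                                     (not-xor-not (lookup S (u e)) (lookup S (v e)))

  module _ (A B : Subset n) (e : Fin (m H)) where

    private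
      x y x′ y′ : Bool
      x  = lookup A (u e)
      y  = lookup B (u e)
      x′ = lookup A (v e)
      y′ = lookup B (v e)

    crosses-∩ : crosses (A ∩ B) e ≡ (x ∧ y) xor (x′ ∧ y′)
    crosses-∩ = cong₂ _xor_ (lookup-∩ A B (u e)) (lookup-∩ A B (v e))

    crosses-∪ : crosses (A ∪ B) e ≡ (x ∨ y) xor (x′ ∨ y′)
    crosses-∪ = cong₂ _xor_ (lookup-∪ A B (u e)) (lookup-∪ A B (v e))

    crosses-─ : crosses (A ─ B) e ≡ (x ∧ not y) xor (x′ ∧ not y′)
    crosses-─ = cong₂ _xor_ (lookup-─ A B (u e)) (lookup-─ A B (v e))

    joins-─ : joins (A ─ B) (B ─ A) e ≡ (x ∧ not y) ∧ (y′ ∧ not x′) ∨ (y ∧ not x) ∧ (x′ ∧ not y′)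
    joins-─ = cong₂ _∨_ (cong₂ _∧_ (lookup-─ A B (u e)) (lookup-─ B A (v e)))
                        (cong₂ _∧_ (lookup-─ B A (u e)) (lookup-─ A B (v e)))

    joins-∩ : joins (A ∩ B) (∁ (A ∪ B)) e ≡ (x ∧ y) ∧ not (x′ ∨ y′) ∨ not (x ∨ y) ∧ (x′ ∧ y′)
    joins-∩ = cong₂ _∨_ (cong₂ _∧_ (lookup-∩ A B (u e)) (∁∪ (v e)))
                        (cong₂ _∧_ (∁∪ (u e)) (lookup-∩ A B (v e)))
      where
      ∁∪ : ∀ i → lookup (∁ (A ∪ B)) i ≡ not (lookup A i ∨ lookup B i)
      ∁∪ i = trans (lookup-∁ (A ∪ B) i) (cong not (lookup-∪ A B i))

  δ-submodular : ∀ A B →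
    ∣ δ H A ∣ + ∣ δ H B ∣ ≡ ∣ δ H (A ∩ B) ∣ + ∣ δ H (A ∪ B) ∣ + 2 * ∣ edgesBetween (A ─ B) (B ─ A) ∣
  δ-submodular A B = ∣tabulate∣-identity _ _ _ _ _ pointwise
    where
    pointwise : ∀ e → toℕ (crosses A e) + toℕ (crosses B e) ≡
      toℕ (crosses (A ∩ B) e) + toℕ (crosses (A ∪ B) e) + 2 * toℕ (joins (A ─ B) (B ─ A) e)
    pointwise e rewrite crosses-∩ A B e | crosses-∪ A B e | joins-─ A B e
      = xor-submodular (lookup A (u e)) (lookup B (u e)) (lookup A (v e)) (lookup B (v e))

  δ-posimodular : ∀ A B →
    ∣ δ H A ∣ + ∣ δ H B ∣ ≡ ∣ δ H (A ─ B) ∣ + ∣ δ H (B ─ A) ∣ + 2 * ∣ edgesBetween (A ∩ B) (∁ (A ∪ B)) ∣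
  δ-posimodular A B = ∣tabulate∣-identity _ _ _ _ _ pointwise
    where
    pointwise : ∀ e → toℕ (crosses A e) + toℕ (crosses B e) ≡
      toℕ (crosses (A ─ B) e) + toℕ (crosses (B ─ A) e) + 2 * toℕ (joins (A ∩ B) (∁ (A ∪ B)) e)
    pointwise e rewrite crosses-─ A B e | crosses-─ B A e | joins-∩ A B e
      = xor-posimodular (lookup A (u e)) (lookup B (u e)) (lookup A (v e)) (lookup B (v e))

  crosses-uncrossˡ : ∀ A B e → joins (A ─ B) (B ─ A) e ≡ false → joins (A ∩ B) (∁ (A ∪ B)) e ≡ false →
    crosses A e ≡ true →
    (crosses (A ∩ B) e ≡ true × crosses (B ─ A) e ≡ true) ⊎ (crosses (A ∪ B) e ≡ true × crosses (A ─ B) e ≡ true)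
  crosses-uncrossˡ A B e
    rewrite joins-─ A B e | joins-∩ A B e | crosses-∩ A B e | crosses-∪ A B e | crosses-─ A B e | crosses-─ B A e
    = xor-uncrossˡ (lookup A (u e)) (lookup B (u e)) (lookup A (v e)) (lookup B (v e))

  crosses-uncrossʳ : ∀ A B e → joins (A ─ B) (B ─ A) e ≡ false → joins (A ∩ B) (∁ (A ∪ B)) e ≡ false →
    crosses B e ≡ true →
    (crosses (A ∩ B) e ≡ true × crosses (A ─ B) e ≡ true) ⊎ (crosses (A ∪ B) e ≡ true × crosses (B ─ A) e ≡ true)
  crosses-uncrossʳ A B e
    rewrite joins-─ A B e | joins-∩ A B e | crosses-∩ A B e | crosses-∪ A B e | crosses-─ A B e | crosses-─ B A e
    = xor-uncrossʳ (lookup A (u e)) (lookup B (u e)) (lookup A (v e)) (lookup B (v e))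

infix 4 _≟ˢ_
_≟ˢ_ : ∀ {n} → DecidableEquality (Subset n)
_≟ˢ_ = ≡-dec Bool._≟_

Proper : ∀ {n} → Subset n → Set
Proper S = S ≢ ⊥ × S ≢ ⊤

module _ {n : ℕ} (k : ℕ) (H : Multigraph n) (U : Subset (m H)) where

  private
    f : Subset n → Bool
    f = fCut k H U

  Uncrossed : Subset n → Subset n → Set
  Uncrossed A B = (f (A ∩ B) ≡ true × f (A ∪ B) ≡ true) ⊎ (f (A ─ B) ≡ true × f (B ─ A) ≡ true)

  fCut≡true⇒ : ∀ S → f S ≡ true → ∣ δ H S ∣ ≡ k × ∃ λ e → crosses H S e ≡ true × e ∈ U
  fCut≡true⇒ S eq =
    let δS≡k , e , e∈δS∩U = does≡true⇒ ((∣ δ H S ∣ ≟ k) ×-dec nonempty? (δ H S ∩ U)) eq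
        e∈δS , e∈U = x∈p∩q⁻ (δ H S) U e∈δS∩U
    in δS≡k , e , ∈δ⇒crosses H S e∈δS , e∈U

  fCut-intro : ∀ S {e} → ∣ δ H S ∣ ≡ k → crosses H S e ≡ true → e ∈ U → f S ≡ true
  fCut-intro S {e} δS≡k c e∈U =
    dec-true ((∣ δ H S ∣ ≟ k) ×-dec nonempty? (δ H S ∩ U)) (δS≡k , e , x∈p∩q⁺ (crosses⇒∈δ H S c , e∈U))

  fCut-∁ : ∀ S → f S ≡ f (∁ S)
  fCut-∁ S = cong (λ D → does (∣ D ∣ ≟ k) ∧ does (nonempty? (D ∩ U))) (sym (δ-∁ H S))

  fCut⇒≢replicate : 0 < k → ∀ {S} → f S ≡ true → ∀ b → S ≢ replicate n b
  fCut⇒≢replicate 0<k fS b refl = <⇒≢ 0<k (begin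
    0                               ≡⟨ ∣⊥∣≡0 (m H) ⟨
    ∣ ⊥ {m H} ∣                     ≡⟨ cong ∣_∣ (δ-replicate H b) ⟨
    ∣ δ H (replicate n b) ∣         ≡⟨ proj₁ (fCut≡true⇒ (replicate n b) fS) ⟩
    k                               ∎)
    where open ≡-Reasoning

  fCut-⊤ : 0 < k → f ⊤ ≡ false
  fCut-⊤ 0<k = ¬-not λ f⊤ → fCut⇒≢replicate 0<k f⊤ true refl

  fCut⇒Proper : 0 < k → ∀ {S} → f S ≡ true → Proper S
  fCut⇒Proper 0<k fS = fCut⇒≢replicate 0<k fS false , fCut⇒≢replicate 0<k fS true

  module _ (ec : EdgeConnected k H) (A B : Subset n) (fA : f A ≡ true) (fB : f B ≡ true) where

    minCuts-tight : ∀ {X Y} {Z : Subset (m H)} → Proper X → Proper Y →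
      ∣ δ H A ∣ + ∣ δ H B ∣ ≡ ∣ δ H X ∣ + ∣ δ H Y ∣ + 2 * ∣ Z ∣ →
      ∣ δ H X ∣ ≡ k × ∣ δ H Y ∣ ≡ k × ∣ Z ∣ ≡ 0
    minCuts-tight {X} {Y} (X≢⊥ , X≢⊤) (Y≢⊥ , Y≢⊤) eq =
      +-tight (ec X X≢⊥ X≢⊤) (ec Y Y≢⊥ Y≢⊤)
        (trans (cong₂ _+_ (sym (proj₁ (fCut≡true⇒ A fA))) (sym (proj₁ (fCut≡true⇒ B fB)))) eq)

    uncross-proper : Proper (A ∩ B) → Proper (A ∪ B) → Proper (A ─ B) → Proper (B ─ A) → Uncrossed A B
    uncross-proper A∩B A∪B A─B B─A with fCut≡true⇒ A fA | fCut≡true⇒ B fB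
    ... | _ , eA , cA , eA∈U | _ , eB , cB , eB∈U =
      combine (crosses-uncrossˡ H A B eA (joins─≡false eA) (joins∩≡false eA) cA)
              (crosses-uncrossʳ H A B eB (joins─≡false eB) (joins∩≡false eB) cB)
      where
      submod : ∣ δ H (A ∩ B) ∣ ≡ k × ∣ δ H (A ∪ B) ∣ ≡ k × ∣ edgesBetween H (A ─ B) (B ─ A) ∣ ≡ 0
      submod = minCuts-tight {Z = edgesBetween H (A ─ B) (B ─ A)} A∩B A∪B (δ-submodular H A B)
      posimod : ∣ δ H (A ─ B) ∣ ≡ k × ∣ δ H (B ─ A) ∣ ≡ k × ∣ edgesBetween H (A ∩ B) (∁ (A ∪ B)) ∣ ≡ 0
      posimod = minCuts-tight {Z = edgesBetween H (A ∩ B) (∁ (A ∪ B))} A─B B─A (δ-posimodular H A B)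
      joins─≡false : ∀ e → joins H (A ─ B) (B ─ A) e ≡ false
      joins─≡false = ∣tabulate∣≡0 _ (proj₂ (proj₂ submod))
      joins∩≡false : ∀ e → joins H (A ∩ B) (∁ (A ∪ B)) e ≡ false
      joins∩≡false = ∣tabulate∣≡0 _ (proj₂ (proj₂ posimod))
      combine :
        (crosses H (A ∩ B) eA ≡ true × crosses H (B ─ A) eA ≡ true)
          ⊎ (crosses H (A ∪ B) eA ≡ true × crosses H (A ─ B) eA ≡ true) →
        (crosses H (A ∩ B) eB ≡ true × crosses H (A ─ B) eB ≡ true)
          ⊎ (crosses H (A ∪ B) eB ≡ true × crosses H (B ─ A) eB ≡ true) →
        Uncrossed A B
      combine (inj₁ (_ , eA∈δB─A)) (inj₁ (_ , eB∈δA─B)) =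
        inj₂ (fCut-intro (A ─ B) (proj₁ posimod) eB∈δA─B eB∈U ,
              fCut-intro (B ─ A) (proj₁ (proj₂ posimod)) eA∈δB─A eA∈U)
      combine (inj₁ (eA∈δA∩B , _)) (inj₂ (eB∈δA∪B , _)) =
        inj₁ (fCut-intro (A ∩ B) (proj₁ submod) eA∈δA∩B eA∈U ,
              fCut-intro (A ∪ B) (proj₁ (proj₂ submod)) eB∈δA∪B eB∈U)
      combine (inj₂ (eA∈δA∪B , _)) (inj₁ (eB∈δA∩B , _)) =
        inj₁ (fCut-intro (A ∩ B) (proj₁ submod) eB∈δA∩B eB∈U ,
              fCut-intro (A ∪ B) (proj₁ (proj₂ submod)) eA∈δA∪B eA∈U)
      combine (inj₂ (_ , eA∈δA─B)) (inj₂ (_ , eB∈δB─A)) =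
        inj₂ (fCut-intro (A ─ B) (proj₁ posimod) eA∈δA─B eA∈U ,
              fCut-intro (B ─ A) (proj₁ (proj₂ posimod)) eB∈δB─A eB∈U)

    uncross : 0 < k → Uncrossed A B
    uncross 0<k with A ∩ B ≟ˢ ⊥ | A ∪ B ≟ˢ ⊤ | A ─ B ≟ˢ ⊥ | B ─ A ≟ˢ ⊥
    ... | yes A∩B≡⊥ | _ | _ | _ =
      inj₂ (trans (cong f (∩≡⊥⇒─≡ A∩B≡⊥)) fA , trans (cong f (∩≡⊥⇒─≡ (trans (∩-comm B A) A∩B≡⊥))) fB)
    ... | no _ | yes A∪B≡⊤ | _ | _ =
      inj₂ (trans (cong f (∪≡⊤⇒─≡∁ A∪B≡⊤)) (trans (sym (fCut-∁ B)) fB) ,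
            trans (cong f (∪≡⊤⇒─≡∁ (trans (∪-comm B A) A∪B≡⊤))) (trans (sym (fCut-∁ A)) fA))
    ... | no _ | no _ | yes A─B≡⊥ | _ =
      inj₁ (trans (cong f (─≡⊥⇒∩≡ A─B≡⊥)) fA , trans (cong f (─≡⊥⇒∪≡ A─B≡⊥)) fB)
    ... | no _ | no _ | no _ | yes B─A≡⊥ =
      inj₁ (trans (cong f (trans (∩-comm A B) (─≡⊥⇒∩≡ B─A≡⊥))) fB ,
            trans (cong f (trans (∪-comm A B) (─≡⊥⇒∪≡ B─A≡⊥))) fA)
    ... | no A∩B≢⊥ | no A∪B≢⊤ | no A─B≢⊥ | no B─A≢⊥ =
      uncross-proper (A∩B≢⊥ , ⊆-≢⊤ (p∩q⊆p A B) A≢⊤) (⊆-≢⊥ (p⊆p∪q B) A≢⊥ , A∪B≢⊤)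
                     (A─B≢⊥ , ⊆-≢⊤ (p─q⊆p A B) A≢⊤) (B─A≢⊥ , ⊆-≢⊤ (p─q⊆p B A) B≢⊤)
      where
      A≢⊥ : A ≢ ⊥
      A≢⊥ = proj₁ (fCut⇒Proper 0<k fA)
      A≢⊤ : A ≢ ⊤
      A≢⊤ = proj₂ (fCut⇒Proper 0<k fA)
      B≢⊤ : B ≢ ⊤
      B≢⊤ = proj₂ (fCut⇒Proper 0<k fB)

lemma3 : ∀ {n : ℕ} (k : ℕ) → k ≥ 1 → (H : Multigraph n) → EdgeConnected k H →
           (U : Subset (m H)) → Uncrossable (fCut k H U)
lemma3 k k≥1 H ec U = fCut-⊤ k H U k≥1 , fCut-∁ k H U , λ A B fA fB → uncross k H U ec A B fA fB k≥1
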